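{- Let $G$ be a finite vertex-transitive graph, and let $A$ be an imprimitive independent set of $G$ of maximum cardinality among all imprimitive independent sets of $G$. Set $B=V(G)\setminus N_G[A]$. Then $\frac{\alpha(B)}{|B|}=\frac{\alpha(G)}{|V(G)|}$, and for every automorphism $\sigma$ of $G$ one has $\sigma(B)\cap B=\emptyset$ or $\sigma(B)=B$; i.e., $\{\sigma(B):\sigma\in\mathrm{Aut}(G)\}$ forms a nontrivial partition of $V(G)$.
   Context: Graphs are finite and simple. $\alpha(G)$ is the independence number of $G$; for $X\subseteq V(G)$, $\alpha(X)$ is the independence number of the subgraph of $G$ induced by $X$. For $A\subseteq V(G)$, $N_G(A)=\{b\in V(G): \{a,b\}\in E(G)\text{ for some }a\in A\}$ and $N_G[A]=N_G(A)\cup A$. An independent set $A$ of a vertex-transitive graph $G$ is called imprimitive if $|A|<\alpha(G)$ and $\frac{|A|}{|N_G[A]|}=\frac{\alpha(G)}{|V(G)|}$. -}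

module Defs where

open import Data.Nat using (ℕ; zero; suc; _⊔_; _<_; _≤_; _*_)
open import Data.Bool using (Bool; true; false; _∧_; _∨_; not; if_then_else_)
open import Data.Fin using (Fin)
open import Data.Fin.Subset using (Subset; _∈_; _⊆_; ∣_∣; ⊤)
open import Data.Fin.Permutation using (Permutation′; _⟨$⟩ʳ_; _⟨$⟩ˡ_)
open import Data.Vec using (Vec; []; _∷_; lookup; tabulate)
open import Data.List using (List; []; _∷_; map; _++_; foldr; allFin; concatMap)
open import Data.Bool.ListAction using (and)
open import Data.Product using (Σ; _×_; ∃)
open import Relation.Binary.PropositionalEquality using (_≡_)

record Graph (n : ℕ) : Set where
  field
    adj     : Fin n → Fin n → Bool
    symm    : ∀ x y → adj x y ≡ adj y x
    irrefl  : ∀ x → adj x x ≡ false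
open Graph public

module _ {n : ℕ} (G : Graph n) where

  IsAutomorphism : Permutation′ n → Set
  IsAutomorphism σ = ∀ x y → adj G (σ ⟨$⟩ʳ x) (σ ⟨$⟩ʳ y) ≡ adj G x y

  VertexTransitive : Set
  VertexTransitive = ∀ x y → Σ (Permutation′ n) λ σ → IsAutomorphism σ × (σ ⟨$⟩ʳ x ≡ y)

  Independent : Subset n → Set
  Independent S = ∀ x y → x ∈ S → y ∈ S → adj G x y ≡ false

  independentᵇ : Subset n → Bool
  independentᵇ S = and (concatMap (λ x → map (λ y →
      not (lookup S x ∧ lookup S y ∧ adj G x y)) (allFin n)) (allFin n))

subsets : (n : ℕ) → List (Subset n)
subsets zero = [] ∷ []
subsets (suc n) = map (true ∷_) (subsets n) ++ map (false ∷_) (subsets n)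

_⊆ᵇ_ : {n : ℕ} → Subset n → Subset n → Bool
[] ⊆ᵇ [] = true
(true ∷ S) ⊆ᵇ (false ∷ X) = false
(_ ∷ S) ⊆ᵇ (_ ∷ X) = S ⊆ᵇ X

module _ {n : ℕ} (G : Graph n) where

  α : Subset n → ℕ
  α X = foldr (λ S m → if (S ⊆ᵇ X) ∧ independentᵇ G S then ∣ S ∣ ⊔ m else m) 0 (subsets n)

  αG : ℕ
  αG = α ⊤

  closedNbhd : Subset n → Subset n
  closedNbhd A = tabulate λ b → lookup A b ∨
      foldr (λ a r → (lookup A a ∧ adj G a b) ∨ r) false (allFin n)

  -- imprimitive independent set: |A| < α(G) and |A|/|N[A]| = α(G)/|V(G)|
  -- (ratio written cross-multiplied; 0 < |A| ensures the ratio is defined,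
  --  since N[A] ⊇ A)
  Imprimitive : Subset n → Set
  Imprimitive A = Independent G A × 0 < ∣ A ∣ × ∣ A ∣ < αG
                  × ∣ A ∣ * n ≡ αG * ∣ closedNbhd A ∣

image : {n : ℕ} → Permutation′ n → Subset n → Subset n
image σ B = tabulate λ y → lookup B (σ ⟨$⟩ˡ y)

-- Averaging over the maps that preserve adjacency and non-adjacency: by vertex-transitivity such a
-- map sends each vertex to a uniformly distributed image.  Averaging shows that preimages of maximum
-- independent sets are maximum, and together with the exchange inequality |P| ≤ |K ∩ N[P]| (K maximum,
-- P independent) that a tight P, i.e. one with |P| n = α(G) |N[P]|, meets every maximum independent set
-- in exactly |P| vertices of N[P].  For B = V ∖ N[A], A ∪ S is independent for every independent
-- S ⊆ B, so α(B) ≤ α(G) − |A| = α(G)|B|/n; averaging the traces of maximum independent sets on B gives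
-- the reverse inequality.
-- For σ ∈ Aut(G) the set σ(A) is again tight.  If B and σ(B) share a vertex t, comparing traces of
-- maximum independent sets shows that A ∪ (σ(A) ∖ N[A]) is tight; it misses N[t], so it is
-- imprimitive, and the maximality of |A| forces σ(A) ⊆ N[A].  Symmetrically A ⊆ N[σ(A)], and then
-- counting a maximum independent set through any vertex of B shows B ⊆ σ(B), and conversely.

module Submission where

open import Defs
open import Data.Nat using (ℕ; _<_; _≤_; _*_)
open import Data.Sum using (_⊎_)
open import Data.Product using (_×_)
open import Data.Fin.Subset using (Subset; ∣_∣; ∁; _∩_; ⊥)
open import Data.Fin.Permutation using (Permutation′)
open import Relation.Binary.PropositionalEquality using (_≡_)

import Algebra.Properties.Semiring.Sum as SemiringSum
import Algebra.Properties.CommutativeSemigroup as CommutativeSemigroupProperties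
open import Data.Bool using (Bool; true; false; _∧_; _∨_; not; if_then_else_) renaming (_≟_ to _≟ᵇ_)
open import Data.Bool.Properties using (∧-comm; ∧-zeroʳ; ∧-identityʳ; ∧-conicalˡ; ∧-conicalʳ)
open import Data.Empty using (⊥-elim)
open import Data.Fin using (Fin; zero; suc; _≟_)
open import Data.Fin.Subset using (⊤)
open import Data.Fin.Properties using (any?; all?)
open import Data.Fin.Permutation using (_⟨$⟩ʳ_; _⟨$⟩ˡ_; inverseˡ; inverseʳ; flip)
open import Data.Nat using (zero; suc; _+_; _∸_; _⊔_; z≤n; NonZero; >-nonZero)
open import Data.Nat.Properties hiding (_≟_)
open import Data.Product using (∃; _,_; proj₁; proj₂)
open import Data.Sum using (inj₁; inj₂)
import Data.Sum as Sum
open import Data.Vec using (Vec; []; _∷_; lookup; tabulate)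
import Data.Vec as Vec
open import Data.Vec.Properties using (lookup∘tabulate; tabulate∘lookup; tabulate-cong; lookup-map; lookup-zipWith; lookup-allFin; lookup-replicate; []=⇒lookup; lookup⇒[]=)
open import Data.List using (List; foldr; allFin)
import Data.List as List
open import Data.List.Membership.Propositional using () renaming (_∈_ to _∈ˡ_)
open import Data.List.Membership.Propositional.Properties using (∈-map⁺; ∈-map⁻; ∈-++⁺ˡ; ∈-++⁺ʳ; ∈-concat⁺′; ∈-concat⁻′; ∈-allFin)
open import Data.List.Relation.Unary.Any using (here; there)
open import Data.Bool.ListAction using (and)
open import Function using (_∘_)
open import Relation.Binary.PropositionalEquality using (refl; sym; trans; cong; cong₂; subst; subst₂; module ≡-Reasoning)
open import Relation.Nullary using (¬_; Dec; does; yes; no)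

open CommutativeSemigroupProperties *-commutativeSemigroup using (x∙yz≈y∙xz)
open SemiringSum +-*-semiring
  using (sum; sum-syntax; sum-cong-≗; ∑-distrib-+; ∑-comm; sum-permute; *-distribˡ-sum; *-distribʳ-sum)

sum-mono : ∀ {n} {f g : Fin n → ℕ} → (∀ i → f i ≤ g i) → sum f ≤ sum g
sum-mono {zero}  f≤g = z≤n
sum-mono {suc n} f≤g = +-mono-≤ (f≤g zero) (sum-mono (f≤g ∘ suc))

sum-const : ∀ n c → ∑[ i < n ] c ≡ n * c
sum-const zero    c = refl
sum-const (suc n) c = cong (c +_) (sum-const n c)

f≤sum : ∀ {n} (f : Fin n → ℕ) i → f i ≤ sum f
f≤sum f zero    = m≤m+n _ _
f≤sum f (suc i) = ≤-trans (f≤sum (f ∘ suc) i) (m≤n+m _ _)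

sum≡0 : ∀ {n} (f : Fin n → ℕ) → sum f ≡ 0 → ∀ i → f i ≡ 0
sum≡0 f Σf≡0 i = n≤0⇒n≡0 (subst (f i ≤_) Σf≡0 (f≤sum f i))

sum-squeeze : ∀ {n} {f g : Fin n → ℕ} → (∀ i → g i ≤ f i) → sum f ≤ sum g → ∀ i → f i ≡ g i
sum-squeeze {n} {f} {g} g≤f Σf≤Σg i = begin-equality
  f i                ≡⟨ m+[n∸m]≡n (g≤f i) ⟨
  g i + (f i ∸ g i)  ≡⟨ cong (g i +_) (sum≡0 d (n≤0⇒n≡0 Σd≤0) i) ⟩
  g i + 0            ≡⟨ +-identityʳ (g i) ⟩
  g i                ∎
  where
  open ≤-Reasoning
  d : Fin n → ℕ
  d j = f j ∸ g j
  Σd≤0 : sum d ≤ 0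
  Σd≤0 = +-cancelˡ-≤ (sum g) _ _ (begin
    sum g + sum d          ≡⟨ ∑-distrib-+ g d ⟨
    sum (λ j → g j + d j)  ≡⟨ sum-cong-≗ (λ j → m+[n∸m]≡n (g≤f j)) ⟩
    sum f                  ≤⟨ Σf≤Σg ⟩
    sum g                  ≡⟨ +-identityʳ (sum g) ⟨
    sum g + 0              ∎)

[_] : Bool → ℕ
[ true  ] = 1
[ false ] = 0

δ : ∀ {n} → Fin n → Fin n → ℕ
δ a v = [ does (a ≟ v) ]

sum-*δ : ∀ {n} (f : Fin n → ℕ) a → ∑[ v < n ] (f v * δ a v) ≡ f a
sum-*δ {suc n} f zero = begin
  f zero * 1 + ∑[ v < n ] (f (suc v) * 0)
    ≡⟨ cong₂ _+_ (*-identityʳ (f zero)) (sum-cong-≗ (*-zeroʳ ∘ f ∘ suc)) ⟩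
  f zero + ∑[ v < n ] 0                    ≡⟨ cong (f zero +_) (trans (sum-const n 0) (*-zeroʳ n)) ⟩
  f zero + 0                               ≡⟨ +-identityʳ (f zero) ⟩
  f zero                                   ∎
  where open ≡-Reasoning
sum-*δ {suc n} f (suc a) =
  trans (cong (_+ ∑[ v < n ] (f (suc v) * δ a v)) (*-zeroʳ (f zero))) (sum-*δ (f ∘ suc) a)

sum-δ : ∀ {n} (a : Fin n) → sum (δ a) ≡ 1
sum-δ a = trans (sum-cong-≗ (λ v → sym (*-identityˡ (δ a v)))) (sum-*δ (λ _ → 1) a)

δ-permute : ∀ {n} (τ : Permutation′ n) a b → δ (τ ⟨$⟩ʳ a) (τ ⟨$⟩ʳ b) ≡ δ a b
δ-permute τ a b with a ≟ b | (τ ⟨$⟩ʳ a) ≟ (τ ⟨$⟩ʳ b)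
... | yes _    | yes _  = refl
... | no  _    | no  _  = refl
... | yes refl | no τa≢τa = ⊥-elim (τa≢τa refl)
... | no a≢b   | yes τa≡τb =
  ⊥-elim (a≢b (trans (sym (inverseˡ τ)) (trans (cong (τ ⟨$⟩ˡ_) τa≡τb) (inverseˡ τ))))

module _ {n : ℕ} where

  ∑ⱽ : ∀ k → (Vec (Fin n) k → ℕ) → ℕ
  ∑ⱽ zero    h = h []
  ∑ⱽ (suc k) h = ∑[ i < n ] ∑ⱽ k (h ∘ (i ∷_))

  ∑ⱽ-cong : ∀ k {f g : Vec (Fin n) k → ℕ} → (∀ v → f v ≡ g v) → ∑ⱽ k f ≡ ∑ⱽ k g
  ∑ⱽ-cong zero    f≗g = f≗g []
  ∑ⱽ-cong (suc k) f≗g = sum-cong-≗ (λ i → ∑ⱽ-cong k (f≗g ∘ (i ∷_)))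

  ∑ⱽ-mono : ∀ k {f g : Vec (Fin n) k → ℕ} → (∀ v → f v ≤ g v) → ∑ⱽ k f ≤ ∑ⱽ k g
  ∑ⱽ-mono zero    f≤g = f≤g []
  ∑ⱽ-mono (suc k) f≤g = sum-mono (λ i → ∑ⱽ-mono k (f≤g ∘ (i ∷_)))

  *-distribˡ-∑ⱽ : ∀ k c (f : Vec (Fin n) k → ℕ) → c * ∑ⱽ k f ≡ ∑ⱽ k (λ v → c * f v)
  *-distribˡ-∑ⱽ zero    c f = refl
  *-distribˡ-∑ⱽ (suc k) c f =
    trans (*-distribˡ-sum c (λ i → ∑ⱽ k (f ∘ (i ∷_)))) (sum-cong-≗ (λ i → *-distribˡ-∑ⱽ k c (f ∘ (i ∷_))))

  ∑ⱽ-comm : ∀ k {m} (h : Vec (Fin n) k → Fin m → ℕ) →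
            ∑ⱽ k (λ v → ∑[ j < m ] h v j) ≡ ∑[ j < m ] ∑ⱽ k (λ v → h v j)
  ∑ⱽ-comm zero    h = refl
  ∑ⱽ-comm (suc k) h =
    trans (sum-cong-≗ (λ i → ∑ⱽ-comm k (h ∘ (i ∷_)))) (∑-comm (λ i j → ∑ⱽ k (λ v → h (i ∷ v) j)))

  f≤∑ⱽ : ∀ k (f : Vec (Fin n) k → ℕ) v → f v ≤ ∑ⱽ k f
  f≤∑ⱽ zero    f []      = ≤-refl
  f≤∑ⱽ (suc k) f (i ∷ v) = ≤-trans (f≤∑ⱽ k (f ∘ (i ∷_)) v) (f≤sum (λ j → ∑ⱽ k (f ∘ (j ∷_))) i)

  ∑ⱽ-squeeze : ∀ k {f g : Vec (Fin n) k → ℕ} → (∀ v → g v ≤ f v) → ∑ⱽ k f ≤ ∑ⱽ k g → ∀ v → f v ≡ g v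
  ∑ⱽ-squeeze zero    g≤f Σf≤Σg []      = ≤-antisym Σf≤Σg (g≤f [])
  ∑ⱽ-squeeze (suc k) g≤f Σf≤Σg (i ∷ v) =
    ∑ⱽ-squeeze k (g≤f ∘ (i ∷_)) (≤-reflexive (sum-squeeze (λ j → ∑ⱽ-mono k (g≤f ∘ (j ∷_))) Σf≤Σg i)) v

  ∑ⱽ-permute : ∀ k (τ : Permutation′ n) (h : Vec (Fin n) k → ℕ) → ∑ⱽ k (h ∘ Vec.map (τ ⟨$⟩ʳ_)) ≡ ∑ⱽ k h
  ∑ⱽ-permute zero    τ h = refl
  ∑ⱽ-permute (suc k) τ h =
    trans (sum-cong-≗ (λ i → ∑ⱽ-permute k τ (h ∘ ((τ ⟨$⟩ʳ i) ∷_))))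
          (sym (sum-permute (λ j → ∑ⱽ k (h ∘ (j ∷_))) τ))

∧-intro : ∀ {a b} → a ≡ true → b ≡ true → a ∧ b ≡ true
∧-intro refl refl = refl

∨-introˡ : ∀ {a} b → a ≡ true → a ∨ b ≡ true
∨-introˡ b refl = refl

∨-introʳ : ∀ a {b} → b ≡ true → a ∨ b ≡ true
∨-introʳ true  _ = refl
∨-introʳ false p = p

∨-elim : ∀ {a b} → a ∨ b ≡ true → a ≡ true ⊎ b ≡ true
∨-elim {true}  _ = inj₁ refl
∨-elim {false} p = inj₂ p

not≡true⇒≡false : ∀ {a} → not a ≡ true → a ≡ false
not≡true⇒≡false {false} _ = refl

not≡false⇒≡true : ∀ {a} → not a ≡ false → a ≡ true
not≡false⇒≡true {true} _ = refl

≡false⇒not≡true : ∀ {a} → a ≡ false → not a ≡ true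
≡false⇒not≡true refl = refl

true≢false : ¬ true ≡ false
true≢false ()

≢true⇒≡false : ∀ {a} → ¬ a ≡ true → a ≡ false
≢true⇒≡false {true}  a≢true = ⊥-elim (a≢true refl)
≢true⇒≡false {false} _      = refl

[]-∧ : ∀ a b → [ a ∧ b ] ≡ [ a ] * [ b ]
[]-∧ true  b = sym (+-identityʳ [ b ])
[]-∧ false b = refl

[]-mono : ∀ {a b} → (a ≡ true → b ≡ true) → [ a ] ≤ [ b ]
[]-mono {true}  a⇒b rewrite a⇒b refl = ≤-refl
[]-mono {false} _ = z≤n

module _ {n : ℕ} where

  infixr 7 _∩ᵖ_
  infixr 6 _∪ᵖ_

  _∩ᵖ_ _∪ᵖ_ : (Fin n → Bool) → (Fin n → Bool) → Fin n → Bool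
  (P ∩ᵖ Q) x = P x ∧ Q x
  (P ∪ᵖ Q) x = P x ∨ Q x

  ∁ᵖ : (Fin n → Bool) → Fin n → Bool
  ∁ᵖ P x = not (P x)

  _⊆ᵖ_ : (Fin n → Bool) → (Fin n → Bool) → Set
  P ⊆ᵖ Q = ∀ x → P x ≡ true → Q x ≡ true

  Disjointᵖ : (Fin n → Bool) → (Fin n → Bool) → Set
  Disjointᵖ P Q = ∀ x → P x ≡ true → Q x ≡ false

  ⊆ᵖ-antisym : ∀ {P Q : Fin n → Bool} → P ⊆ᵖ Q → Q ⊆ᵖ P → ∀ x → P x ≡ Q x
  ⊆ᵖ-antisym {P = P} {Q} P⊆Q Q⊆P x with P x in Px | Q x in Qx
  ... | true  | true  = refl
  ... | false | false = refl
  ... | true  | false = trans (sym (P⊆Q x Px)) Qx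
  ... | false | true  = trans (sym Px) (Q⊆P x Qx)

  count : (Fin n → Bool) → ℕ
  count P = ∑[ x < n ] [ P x ]

  count-cong : ∀ {P Q} → (∀ x → P x ≡ Q x) → count P ≡ count Q
  count-cong P≗Q = sum-cong-≗ (cong [_] ∘ P≗Q)

  count-split : ∀ P Q → count P ≡ count (P ∩ᵖ Q) + count (P ∩ᵖ ∁ᵖ Q)
  count-split P Q = trans (sum-cong-≗ (λ x → split (P x) (Q x))) (∑-distrib-+ (λ x → [ P x ∧ Q x ]) _)
    where
    split : ∀ p q → [ p ] ≡ [ p ∧ q ] + [ p ∧ not q ]
    split true  true  = refl
    split true  false = refl
    split false _     = refl

  count-∪ : ∀ P Q → Disjointᵖ P Q → count (P ∪ᵖ Q) ≡ count P + count Q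
  count-∪ P Q P∩Q≡∅ = trans (sum-cong-≗ (λ x → union (P x) (Q x) (P∩Q≡∅ x))) (∑-distrib-+ (λ x → [ P x ]) _)
    where
    union : ∀ p q → (p ≡ true → q ≡ false) → [ p ∨ q ] ≡ [ p ] + [ q ]
    union true  _ p⇒¬q rewrite p⇒¬q refl = refl
    union false _ _    = refl

  count-mono : ∀ {P Q} → P ⊆ᵖ Q → count P ≤ count Q
  count-mono P⊆Q = sum-mono (λ x → []-mono (P⊆Q x))

  count-⊤ : count (λ _ → true) ≡ n
  count-⊤ = trans (sum-const n 1) (*-identityʳ n)

  n≡count+count∁ : ∀ P → n ≡ count P + count (∁ᵖ P)
  n≡count+count∁ P = trans (sym count-⊤) (count-split (λ _ → true) P)

  count≡0 : ∀ {P} → count P ≡ 0 → ∀ x → P x ≡ false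
  count≡0 {P} ∣P∣≡0 x with P x | sum≡0 (λ y → [ P y ]) ∣P∣≡0 x
  ... | false | _  = refl
  ... | true  | ()

  count-≤⇒⊇ : ∀ {P Q} → P ⊆ᵖ Q → count Q ≤ count P → Q ⊆ᵖ P
  count-≤⇒⊇ {P} {Q} P⊆Q ∣Q∣≤∣P∣ x Qx with P x | sum-squeeze (λ y → []-mono (P⊆Q y)) ∣Q∣≤∣P∣ x
  ... | true  | _         = refl
  ... | false | ∣Qx∣≡∣Px∣ = ⊥-elim (1+n≢0 (subst (λ b → [ b ] ≡ 0) Qx ∣Qx∣≡∣Px∣))

  count-∅ : ∀ {P} → (∀ x → P x ≡ false) → count P ≡ 0
  count-∅ P≡∅ = trans (sum-cong-≗ (cong [_] ∘ P≡∅)) (trans (sum-const n 0) (*-zeroʳ n))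

  count-pos⇒∈ : ∀ {P} → 0 < count P → ∃ λ x → P x ≡ true
  count-pos⇒∈ {P} 0<∣P∣ with any? (λ x → P x ≟ᵇ true)
  ... | yes ∃x = ∃x
  ... | no  ∄x = ⊥-elim (<⇒≢ 0<∣P∣ (sym (count-∅ (λ x → ≢true⇒≡false (λ Px → ∄x (x , Px))))))

  count-permute : ∀ (τ : Permutation′ n) P → count (P ∘ (τ ⟨$⟩ʳ_)) ≡ count P
  count-permute τ P = sym (sum-permute (λ x → [ P x ]) τ)

∣∣≡count : ∀ {n} (S : Subset n) → ∣ S ∣ ≡ count (lookup S)
∣∣≡count []          = refl
∣∣≡count (true ∷ S)  = cong suc (∣∣≡count S)
∣∣≡count (false ∷ S) = ∣∣≡count S

lookup-ext : ∀ {A : Set} {n} {u v : Vec A n} → (∀ i → lookup u i ≡ lookup v i) → u ≡ v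
lookup-ext {u = u} {v} u≗v = trans (sym (tabulate∘lookup u)) (trans (tabulate-cong u≗v) (tabulate∘lookup v))

any-sound : ∀ {n} (f : Fin n → Bool) → foldr (λ a r → f a ∨ r) false (allFin n) ≡ true → ∃ λ a → f a ≡ true
any-sound f = go (allFin _)
  where
  go : ∀ xs → foldr (λ a r → f a ∨ r) false xs ≡ true → ∃ λ a → f a ≡ true
  go (x List.∷ xs) p with ∨-elim {f x} p
  ... | inj₁ fx = x , fx
  ... | inj₂ q  = go xs q

any-complete : ∀ {n} (f : Fin n → Bool) a → f a ≡ true → foldr (λ a r → f a ∨ r) false (allFin n) ≡ true
any-complete f a fa = go (allFin _) (∈-allFin a)
  where
  go : ∀ xs → a ∈ˡ xs → foldr (λ a r → f a ∨ r) false xs ≡ true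
  go (x List.∷ xs) (here refl) = ∨-introˡ _ fa
  go (x List.∷ xs) (there a∈) = ∨-introʳ (f x) (go xs a∈)

and-sound : ∀ {bs} → and bs ≡ true → ∀ {b} → b ∈ˡ bs → b ≡ true
and-sound {x List.∷ _} p (here refl) = ∧-conicalˡ x _ p
and-sound {x List.∷ _} p (there b∈)  = and-sound (∧-conicalʳ x _ p) b∈

and-complete : ∀ bs → (∀ {b} → b ∈ˡ bs → b ≡ true) → and bs ≡ true
and-complete List.[]       _     = refl
and-complete (x List.∷ bs) all∈ = ∧-intro (all∈ (here refl)) (and-complete bs (all∈ ∘ there))

∈-subsets : ∀ {n} (S : Subset n) → S ∈ˡ subsets n
∈-subsets []                = here refl
∈-subsets {suc n} (true ∷ S)  = ∈-++⁺ˡ (∈-map⁺ (true ∷_) (∈-subsets S))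
∈-subsets {suc n} (false ∷ S) = ∈-++⁺ʳ (List.map (true ∷_) (subsets n)) (∈-map⁺ (false ∷_) (∈-subsets S))

⊆ᵇ-sound : ∀ {n} (S X : Subset n) → S ⊆ᵇ X ≡ true → lookup S ⊆ᵖ lookup X
⊆ᵇ-sound (true  ∷ S) (true  ∷ X) _ zero    _  = refl
⊆ᵇ-sound (true  ∷ S) (true  ∷ X) p (suc i) Si = ⊆ᵇ-sound S X p i Si
⊆ᵇ-sound (false ∷ S) (true  ∷ X) p (suc i) Si = ⊆ᵇ-sound S X p i Si
⊆ᵇ-sound (false ∷ S) (false ∷ X) p (suc i) Si = ⊆ᵇ-sound S X p i Si

⊆ᵇ-complete : ∀ {n} (S X : Subset n) → lookup S ⊆ᵖ lookup X → S ⊆ᵇ X ≡ true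
⊆ᵇ-complete []          []          _   = refl
⊆ᵇ-complete (true  ∷ S) (true  ∷ X) S⊆X = ⊆ᵇ-complete S X (S⊆X ∘ suc)
⊆ᵇ-complete (true  ∷ S) (false ∷ X) S⊆X = S⊆X zero refl
⊆ᵇ-complete (false ∷ S) (true  ∷ X) S⊆X = ⊆ᵇ-complete S X (S⊆X ∘ suc)
⊆ᵇ-complete (false ∷ S) (false ∷ X) S⊆X = ⊆ᵇ-complete S X (S⊆X ∘ suc)

module _ {n : ℕ} (c : Subset n → Bool) where

  maxCard : List (Subset n) → ℕ
  maxCard = foldr (λ S m → if c S then ∣ S ∣ ⊔ m else m) 0

  maxCard-upper : ∀ L S → S ∈ˡ L → c S ≡ true → ∣ S ∣ ≤ maxCard L
  maxCard-upper (S′ List.∷ L) S (here refl) cS rewrite cS = m≤m⊔n ∣ S ∣ (maxCard L)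
  maxCard-upper (S′ List.∷ L) S (there S∈) cS with c S′
  ... | true  = ≤-trans (maxCard-upper L S S∈ cS) (m≤n⊔m ∣ S′ ∣ (maxCard L))
  ... | false = maxCard-upper L S S∈ cS

  maxCard-attained : ∀ L → maxCard L ≡ 0 ⊎ ∃ λ S → c S ≡ true × ∣ S ∣ ≡ maxCard L
  maxCard-attained List.[]       = inj₁ refl
  maxCard-attained (S List.∷ L) with c S in cS
  ... | false = maxCard-attained L
  ... | true with ⊔-sel ∣ S ∣ (maxCard L) | maxCard-attained L
  ...   | inj₁ ⊔≡S | _                  = inj₂ (S , cS , sym ⊔≡S)
  ...   | inj₂ ⊔≡m | inj₂ (S′ , cS′ , e) = inj₂ (S′ , cS′ , trans e (sym ⊔≡m))
  ...   | inj₂ ⊔≡m | inj₁ m≡0           = inj₂ (S , cS , sym (m≥n⇒m⊔n≡m (subst (_≤ ∣ S ∣) (sym m≡0) z≤n)))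

-- Independent sets and closed neighbourhoods

module Independence {n : ℕ} (G : Graph n) where

  IsIndependent : (Fin n → Bool) → Set
  IsIndependent P = ∀ x y → P x ≡ true → P y ≡ true → adj G x y ≡ false

  Independent⇒IsIndependent : ∀ S → Independent G S → IsIndependent (lookup S)
  Independent⇒IsIndependent S ind x y Sx Sy = ind x y (lookup⇒[]= x S Sx) (lookup⇒[]= y S Sy)

  IsIndependent⇒Independent : ∀ S → IsIndependent (lookup S) → Independent G S
  IsIndependent⇒Independent S ind x y x∈S y∈S = ind x y ([]=⇒lookup x∈S) ([]=⇒lookup y∈S)

  IsIndependent-⊆ : ∀ {P Q} → P ⊆ᵖ Q → IsIndependent Q → IsIndependent P
  IsIndependent-⊆ P⊆Q indQ x y Px Py = indQ x y (P⊆Q x Px) (P⊆Q y Py)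

  private
    edgeFree : Subset n → Fin n → Fin n → Bool
    edgeFree S x y = not (lookup S x ∧ lookup S y ∧ adj G x y)

  independentᵇ-sound : ∀ S → independentᵇ G S ≡ true → IsIndependent (lookup S)
  independentᵇ-sound S p x y Sx Sy = nonadj (lookup S x) (lookup S y) (adj G x y) Sx Sy
      (and-sound p (∈-concat⁺′ (∈-map⁺ (edgeFree S x) (∈-allFin y))
                               (∈-map⁺ (λ x → List.map (edgeFree S x) (allFin n)) (∈-allFin x))))
    where
    nonadj : ∀ a b e → a ≡ true → b ≡ true → not (a ∧ b ∧ e) ≡ true → e ≡ false
    nonadj true true false _ _ _ = refl

  independentᵇ-complete : ∀ S → IsIndependent (lookup S) → independentᵇ G S ≡ true
  independentᵇ-complete S ind = and-complete _ all-edgeFree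
    where
    rows : List (List Bool)
    rows = List.map (λ x → List.map (edgeFree S x) (allFin n)) (allFin n)
    passes : ∀ a b e → (a ≡ true → b ≡ true → e ≡ false) → not (a ∧ b ∧ e) ≡ true
    passes true  true  e a⇒b⇒¬e rewrite a⇒b⇒¬e refl refl = refl
    passes true  false e _ = refl
    passes false b     e _ = refl
    all-edgeFree : ∀ {b} → b ∈ˡ List.concat rows → b ≡ true
    all-edgeFree b∈ with ∈-concat⁻′ rows b∈
    ... | bs , b∈bs , bs∈ with ∈-map⁻ (λ x → List.map (edgeFree S x) (allFin n)) bs∈
    ... | x , _ , refl with ∈-map⁻ (edgeFree S x) b∈bs
    ... | y , _ , refl = passes (lookup S x) (lookup S y) (adj G x y) (ind x y)

  α-upper : ∀ X {P} → IsIndependent P → P ⊆ᵖ lookup X → count P ≤ α G X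
  α-upper X {P} indP P⊆X =
    subst (_≤ α G X) (trans (∣∣≡count S) (count-cong (lookup∘tabulate P)))
      (maxCard-upper (λ S → (S ⊆ᵇ X) ∧ independentᵇ G S) (subsets n) S (∈-subsets S)
        (∧-intro (⊆ᵇ-complete S X (λ x Sx → P⊆X x (S→P x Sx)))
                 (independentᵇ-complete S (λ x y Sx Sy → indP x y (S→P x Sx) (S→P y Sy)))))
    where
    S : Subset n
    S = tabulate P
    S→P : lookup S ⊆ᵖ P
    S→P x = trans (sym (lookup∘tabulate P x))

  α-attained : ∀ X → ∃ λ P → IsIndependent P × P ⊆ᵖ lookup X × count P ≡ α G X
  α-attained X with maxCard-attained (λ S → (S ⊆ᵇ X) ∧ independentᵇ G S) (subsets n)
  ... | inj₁ α≡0 =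
    (λ _ → false) , (λ _ _ ()) , (λ _ ()) , trans (count-∅ {n} {λ _ → false} (λ _ → refl)) (sym α≡0)
  ... | inj₂ (S , cS , ∣S∣≡α) =
    lookup S , independentᵇ-sound S (∧-conicalʳ (S ⊆ᵇ X) _ cS) , ⊆ᵇ-sound S X (∧-conicalˡ _ _ cS) ,
    trans (sym (∣∣≡count S)) ∣S∣≡α

  N[_] : (Fin n → Bool) → Fin n → Bool
  N[ P ] b = P b ∨ foldr (λ a r → (P a ∧ adj G a b) ∨ r) false (allFin n)

  lookup-closedNbhd : ∀ A b → lookup (closedNbhd G A) b ≡ N[ lookup A ] b
  lookup-closedNbhd A = lookup∘tabulate N[ lookup A ]

  P⊆N[P] : ∀ {P} → P ⊆ᵖ N[ P ]
  P⊆N[P] x Px = ∨-introˡ _ Px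

  adj⇒∈N[] : ∀ {P} a x → P a ≡ true → adj G a x ≡ true → N[ P ] x ≡ true
  adj⇒∈N[] {P} a x Pa a~x = ∨-introʳ (P x) (any-complete (λ a → P a ∧ adj G a x) a (∧-intro Pa a~x))

  ∈N[]-elim : ∀ {P} x → N[ P ] x ≡ true → P x ≡ true ⊎ ∃ λ a → P a ≡ true × adj G a x ≡ true
  ∈N[]-elim {P} x x∈N with ∨-elim {P x} x∈N
  ... | inj₁ Px = inj₁ Px
  ... | inj₂ p with any-sound (λ a → P a ∧ adj G a x) p
  ... | a , Pa∧a~x = inj₂ (a , ∧-conicalˡ _ _ Pa∧a~x , ∧-conicalʳ (P a) _ Pa∧a~x)

  N[]-mono : ∀ {P Q} → P ⊆ᵖ Q → N[ P ] ⊆ᵖ N[ Q ]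
  N[]-mono P⊆Q x x∈N with ∈N[]-elim x x∈N
  ... | inj₁ Px              = P⊆N[P] x (P⊆Q x Px)
  ... | inj₂ (a , Pa , a~x) = adj⇒∈N[] a x (P⊆Q a Pa) a~x

  N[]-cong : ∀ {P Q} → (∀ x → P x ≡ Q x) → ∀ x → N[ P ] x ≡ N[ Q ] x
  N[]-cong P≗Q = ⊆ᵖ-antisym (N[]-mono (λ x → trans (sym (P≗Q x)))) (N[]-mono (λ x → trans (P≗Q x)))

  N[]-∪ : ∀ P Q x → N[ P ∪ᵖ Q ] x ≡ (N[ P ] ∪ᵖ N[ Q ]) x
  N[]-∪ P Q = ⊆ᵖ-antisym N[P∪Q]⊆ N⊆N[P∪Q]
    where
    N[P∪Q]⊆ : N[ P ∪ᵖ Q ] ⊆ᵖ (N[ P ] ∪ᵖ N[ Q ])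
    N[P∪Q]⊆ x x∈N with ∈N[]-elim x x∈N
    ... | inj₁ x∈P∪Q with ∨-elim {P x} x∈P∪Q
    ...   | inj₁ Px = ∨-introˡ (N[ Q ] x) (P⊆N[P] {P} x Px)
    ...   | inj₂ Qx = ∨-introʳ (N[ P ] x) (P⊆N[P] {Q} x Qx)
    N[P∪Q]⊆ x x∈N | inj₂ (a , a∈P∪Q , a~x) with ∨-elim {P a} a∈P∪Q
    ...   | inj₁ Pa = ∨-introˡ (N[ Q ] x) (adj⇒∈N[] {P} a x Pa a~x)
    ...   | inj₂ Qa = ∨-introʳ (N[ P ] x) (adj⇒∈N[] {Q} a x Qa a~x)
    N⊆N[P∪Q] : (N[ P ] ∪ᵖ N[ Q ]) ⊆ᵖ N[ P ∪ᵖ Q ]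
    N⊆N[P∪Q] x x∈N with ∨-elim {N[ P ] x} x∈N
    ... | inj₁ x∈NP = N[]-mono (λ y → ∨-introˡ (Q y)) x x∈NP
    ... | inj₂ x∈NQ = N[]-mono (λ y → ∨-introʳ (P y)) x x∈NQ

  ∁N[]-nonadj : ∀ {P} a x → P a ≡ true → ∁ᵖ N[ P ] x ≡ true → adj G a x ≡ false
  ∁N[]-nonadj a x Pa x∉N = ≢true⇒≡false (λ a~x → true≢false (trans (sym (adj⇒∈N[] a x Pa a~x)) (not≡true⇒≡false x∉N)))

  P∩∁N[P]≡∅ : ∀ {P} → Disjointᵖ P (∁ᵖ N[ P ])
  P∩∁N[P]≡∅ x Px = cong not (P⊆N[P] x Px)

  ⊆∁N[]-sym : ∀ {P Q} → Q ⊆ᵖ ∁ᵖ N[ P ] → P ⊆ᵖ ∁ᵖ N[ Q ]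
  ⊆∁N[]-sym {P} {Q} Q⊆∁NP x Px = ≡false⇒not≡true (≢true⇒≡false x∉N[Q])
    where
    x∉N[Q] : ¬ N[ Q ] x ≡ true
    x∉N[Q] x∈N with ∈N[]-elim x x∈N
    ... | inj₁ Qx = true≢false (trans (sym (Q⊆∁NP x Qx)) (P∩∁N[P]≡∅ x Px))
    ... | inj₂ (a , Qa , a~x) =
      true≢false (trans (sym a~x) (trans (symm G a x) (∁N[]-nonadj x a Px (Q⊆∁NP a Qa))))

  IsIndependent-∪-∁N[] : ∀ {P Q} → IsIndependent P → IsIndependent Q → Q ⊆ᵖ ∁ᵖ N[ P ] →
                          IsIndependent (P ∪ᵖ Q)
  IsIndependent-∪-∁N[] {P} indP indQ Q⊆∁N x y x∈ y∈ with ∨-elim {P x} x∈ | ∨-elim {P y} y∈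
  ... | inj₁ Px | inj₁ Py = indP x y Px Py
  ... | inj₂ Qx | inj₂ Qy = indQ x y Qx Qy
  ... | inj₁ Px | inj₂ Qy = ∁N[]-nonadj x y Px (Q⊆∁N y Qy)
  ... | inj₂ Qx | inj₁ Py = trans (symm G x y) (∁N[]-nonadj y x Py (Q⊆∁N x Qx))

  count-∪-∁N[] : ∀ {P Q} → Q ⊆ᵖ ∁ᵖ N[ P ] → count (P ∪ᵖ Q) ≡ count P + count Q
  count-∪-∁N[] {P} {Q} Q⊆∁N = count-∪ P Q λ x Px →
    ≢true⇒≡false (λ Qx → true≢false (trans (sym (Q⊆∁N x Qx)) (P∩∁N[P]≡∅ x Px)))

  IsMaximum : (Fin n → Bool) → Set
  IsMaximum I = IsIndependent I × count I ≡ αG G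

  maximum-exists : ∃ IsMaximum
  maximum-exists with α-attained ⊤
  ... | I , indI , _ , ∣I∣≡α = I , indI , ∣I∣≡α

  count≤αG : ∀ {P} → IsIndependent P → count P ≤ αG G
  count≤αG indP = α-upper ⊤ indP (λ x _ → lookup-replicate x true)

  count-∪-∁N[]≤αG : ∀ {P Q} → IsIndependent P → IsIndependent Q → Q ⊆ᵖ ∁ᵖ N[ P ] →
                     count P + count Q ≤ αG G
  count-∪-∁N[]≤αG indP indQ Q⊆∁N =
    subst (_≤ αG G) (count-∪-∁N[] Q⊆∁N) (count≤αG (IsIndependent-∪-∁N[] indP indQ Q⊆∁N))

  exchange : ∀ {K P} → IsMaximum K → IsIndependent P → count P ≤ count (K ∩ᵖ N[ P ])
  exchange {K} {P} (indK , ∣K∣≡α) indP = +-cancelʳ-≤ (count (K ∩ᵖ ∁ᵖ N[ P ])) _ _ (begin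
    count P + count (K ∩ᵖ ∁ᵖ N[ P ])
      ≤⟨ count-∪-∁N[]≤αG indP (IsIndependent-⊆ (λ x → ∧-conicalˡ _ _) indK) (λ x → ∧-conicalʳ (K x) _) ⟩
    αG G
      ≡⟨ trans (sym ∣K∣≡α) (count-split K N[ P ]) ⟩
    count (K ∩ᵖ N[ P ]) + count (K ∩ᵖ ∁ᵖ N[ P ]) ∎)
    where open ≤-Reasoning

  IsStrongEndo : Vec (Fin n) n → Set
  IsStrongEndo φ = ∀ x y → adj G (lookup φ x) (lookup φ y) ≡ adj G x y

  IsIndependent-preimage : ∀ {I} φ → IsStrongEndo φ → IsIndependent I → IsIndependent (I ∘ lookup φ)
  IsIndependent-preimage φ φ-endo indI x y Iφx Iφy = trans (sym (φ-endo x y)) (indI _ _ Iφx Iφy)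

  automorphism-inverse : ∀ {τ} → IsAutomorphism G τ → IsAutomorphism G (flip τ)
  automorphism-inverse {τ} τ-aut x y = trans (sym (τ-aut _ _)) (cong₂ (adj G) (inverseʳ τ) (inverseʳ τ))

  module _ {τ : Permutation′ n} (τ-aut : IsAutomorphism G τ) where

    IsIndependent-∘-automorphism : ∀ {P} → IsIndependent P → IsIndependent (P ∘ (τ ⟨$⟩ʳ_))
    IsIndependent-∘-automorphism indP x y Pτx Pτy = trans (sym (τ-aut x y)) (indP _ _ Pτx Pτy)

    N[]-∘-automorphism : ∀ P x → N[ P ∘ (τ ⟨$⟩ʳ_) ] x ≡ N[ P ] (τ ⟨$⟩ʳ x)
    N[]-∘-automorphism P = ⊆ᵖ-antisym N[P∘τ]⊆ N[P]∘τ⊆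
      where
      N[P∘τ]⊆ : N[ P ∘ (τ ⟨$⟩ʳ_) ] ⊆ᵖ (N[ P ] ∘ (τ ⟨$⟩ʳ_))
      N[P∘τ]⊆ x x∈N with ∈N[]-elim x x∈N
      ... | inj₁ Pτx            = P⊆N[P] {P} _ Pτx
      ... | inj₂ (a , Pτa , a~x) = adj⇒∈N[] _ _ Pτa (trans (τ-aut a x) a~x)
      N[P]∘τ⊆ : (N[ P ] ∘ (τ ⟨$⟩ʳ_)) ⊆ᵖ N[ P ∘ (τ ⟨$⟩ʳ_) ]
      N[P]∘τ⊆ x τx∈N with ∈N[]-elim (τ ⟨$⟩ʳ x) τx∈N
      ... | inj₁ Pτx             = P⊆N[P] {P ∘ (τ ⟨$⟩ʳ_)} x Pτx
      ... | inj₂ (b , Pb , b~τx) =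
        adj⇒∈N[] (τ ⟨$⟩ˡ b) x (trans (cong P (inverseʳ τ)) Pb)
          (trans (sym (τ-aut _ x)) (trans (cong (λ c → adj G c _) (inverseʳ τ)) b~τx))

    maximum-∘-automorphism : ∀ {I} → IsMaximum I → IsMaximum (I ∘ (τ ⟨$⟩ʳ_))
    maximum-∘-automorphism {I} (indI , ∣I∣≡α) =
      IsIndependent-∘-automorphism indI , trans (count-permute τ I) ∣I∣≡α

-- Averaging over strong endomorphisms

module Averaging {n : ℕ} (G : Graph n) (vt : VertexTransitive G) where
  open Independence G

  -- Opaque, so that w φ stays blocked on isStrongEndo? φ and `with isStrongEndo? φ` abstracts it.
  opaque
    isStrongEndo? : ∀ φ → Dec (IsStrongEndo φ)
    isStrongEndo? φ = all? λ x → all? λ y → adj G (lookup φ x) (lookup φ y) ≟ᵇ adj G x y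

  private
    w : Vec (Fin n) n → ℕ
    w φ = [ does (isStrongEndo? φ) ]

    w-endo : ∀ {φ} → IsStrongEndo φ → w φ ≡ 1
    w-endo {φ} φ-endo with isStrongEndo? φ
    ... | yes _ = refl
    ... | no ¬φ-endo = ⊥-elim (¬φ-endo φ-endo)

    weighted : ∀ (_R_ : ℕ → ℕ → Set) {f g : Vec (Fin n) n → ℕ} → 0 R 0 →
               (∀ φ → IsStrongEndo φ → f φ R g φ) → ∀ φ → (w φ * f φ) R (w φ * g φ)
    weighted _R_ {f} {g} 0R0 fRg φ with isStrongEndo? φ
    ... | yes φ-endo = subst₂ _R_ (sym (+-identityʳ (f φ))) (sym (+-identityʳ (g φ))) (fRg φ φ-endo)
    ... | no _       = 0R0

  -- ∑ᴱ sums over all strong endomorphisms, encoded as vectors so that ∑ⱽ can enumerate them.  They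
  -- replace the automorphism group of the classical argument: the family is closed under composition
  -- with automorphisms, so vertex-transitivity makes the image of each vertex uniformly distributed.
  ∑ᴱ : (Vec (Fin n) n → ℕ) → ℕ
  ∑ᴱ f = ∑ⱽ n (λ φ → w φ * f φ)

  #E : ℕ
  #E = ∑ᴱ (λ _ → 1)

  ∑ᴱ-cong : ∀ {f g} → (∀ φ → IsStrongEndo φ → f φ ≡ g φ) → ∑ᴱ f ≡ ∑ᴱ g
  ∑ᴱ-cong f≗g = ∑ⱽ-cong n (weighted _≡_ refl f≗g)

  ∑ᴱ-mono : ∀ {f g} → (∀ φ → IsStrongEndo φ → f φ ≤ g φ) → ∑ᴱ f ≤ ∑ᴱ g
  ∑ᴱ-mono f≤g = ∑ⱽ-mono n (weighted _≤_ z≤n f≤g)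

  ∑ᴱ-squeeze : ∀ {f g} → (∀ φ → IsStrongEndo φ → g φ ≤ f φ) → ∑ᴱ f ≤ ∑ᴱ g →
               ∀ φ → IsStrongEndo φ → f φ ≡ g φ
  ∑ᴱ-squeeze {f} {g} g≤f Σf≤Σg φ φ-endo = begin
    f φ          ≡⟨ +-identityʳ (f φ) ⟨
    1 * f φ      ≡⟨ cong (_* f φ) (w-endo φ-endo) ⟨
    w φ * f φ    ≡⟨ ∑ⱽ-squeeze n (weighted _≤_ z≤n g≤f) Σf≤Σg φ ⟩
    w φ * g φ    ≡⟨ cong (_* g φ) (w-endo φ-endo) ⟩
    1 * g φ      ≡⟨ +-identityʳ (g φ) ⟩
    g φ          ∎
    where open ≡-Reasoning

  *-distribˡ-∑ᴱ : ∀ c f → c * ∑ᴱ f ≡ ∑ᴱ (λ φ → c * f φ)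
  *-distribˡ-∑ᴱ c f = trans (*-distribˡ-∑ⱽ n c _) (∑ⱽ-cong n (λ φ → x∙yz≈y∙xz c (w φ) (f φ)))

  ∑ᴱ-const : ∀ c → ∑ᴱ (λ _ → c) ≡ c * #E
  ∑ᴱ-const c = sym (trans (*-distribˡ-∑ᴱ c (λ _ → 1)) (∑ᴱ-cong (λ _ _ → *-identityʳ c)))

  ∑ᴱ-comm : ∀ {m} (h : Vec (Fin n) n → Fin m → ℕ) → ∑ᴱ (λ φ → ∑[ i < m ] h φ i) ≡ ∑[ i < m ] ∑ᴱ (λ φ → h φ i)
  ∑ᴱ-comm h = trans (∑ⱽ-cong n (λ φ → *-distribˡ-sum (w φ) (h φ))) (∑ⱽ-comm n (λ φ i → w φ * h φ i))

  ∑ᴱ-lowerBound-tight : ∀ {f} c → (∀ φ → IsStrongEndo φ → c ≤ f φ) → ∑ᴱ f ≤ c * #E →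
                        ∀ φ → IsStrongEndo φ → f φ ≡ c
  ∑ᴱ-lowerBound-tight {f} c c≤f Σf≤c#E = ∑ᴱ-squeeze c≤f (subst (∑ᴱ f ≤_) (sym (∑ᴱ-const c)) Σf≤c#E)

  ∑ᴱ-upperBound-tight : ∀ {f} c → (∀ φ → IsStrongEndo φ → f φ ≤ c) → c * #E ≤ ∑ᴱ f →
                        ∀ φ → IsStrongEndo φ → f φ ≡ c
  ∑ᴱ-upperBound-tight {f} c f≤c c#E≤Σf φ φ-endo =
    sym (∑ᴱ-squeeze f≤c (subst (_≤ ∑ᴱ f) (sym (∑ᴱ-const c)) c#E≤Σf) φ φ-endo)

  ∑ᴱ-upperBound : ∀ {f} c → (∀ φ → IsStrongEndo φ → f φ ≤ c) → ∑ᴱ f ≤ c * #E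
  ∑ᴱ-upperBound {f} c f≤c = subst (∑ᴱ f ≤_) (∑ᴱ-const c) (∑ᴱ-mono f≤c)

  id-endo : IsStrongEndo (Vec.allFin n)
  id-endo x y = cong₂ (adj G) (lookup-allFin x) (lookup-allFin y)

  #E-pos : 0 < #E
  #E-pos = subst (λ k → k * 1 ≤ #E) (w-endo id-endo) (f≤∑ⱽ n (λ φ → w φ * 1) (Vec.allFin n))

  module _ {τ : Permutation′ n} (τ-aut : IsAutomorphism G τ) where

    private
      τ∘ : Vec (Fin n) n → Vec (Fin n) n
      τ∘ = Vec.map (τ ⟨$⟩ʳ_)

      adj-τ∘ : ∀ φ x y → adj G (lookup (τ∘ φ) x) (lookup (τ∘ φ) y) ≡ adj G (lookup φ x) (lookup φ y)
      adj-τ∘ φ x y = trans (cong₂ (adj G) (lookup-map x _ φ) (lookup-map y _ φ)) (τ-aut _ _)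

      w-τ∘ : ∀ φ → w (τ∘ φ) ≡ w φ
      w-τ∘ φ with isStrongEndo? φ | isStrongEndo? (τ∘ φ)
      ... | yes _      | yes _      = refl
      ... | no  _      | no  _      = refl
      ... | yes φ-endo | no ¬τφ-endo = ⊥-elim (¬τφ-endo (λ x y → trans (adj-τ∘ φ x y) (φ-endo x y)))
      ... | no ¬φ-endo | yes τφ-endo = ⊥-elim (¬φ-endo (λ x y → trans (sym (adj-τ∘ φ x y)) (τφ-endo x y)))

    ∑ᴱ-∘-automorphism : ∀ f → ∑ᴱ (f ∘ Vec.map (τ ⟨$⟩ʳ_)) ≡ ∑ᴱ f
    ∑ᴱ-∘-automorphism f =
      trans (∑ⱽ-cong n (λ φ → cong (_* f (τ∘ φ)) (sym (w-τ∘ φ)))) (∑ⱽ-permute n τ (λ φ → w φ * f φ))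

  hits : Fin n → Fin n → ℕ
  hits x v = ∑ᴱ (λ φ → δ (lookup φ x) v)

  hits-automorphism : ∀ {τ} → IsAutomorphism G τ → ∀ x v → hits x (τ ⟨$⟩ʳ v) ≡ hits x v
  hits-automorphism {τ} τ-aut x v = begin
    ∑ᴱ (λ φ → δ (lookup φ x) (τ ⟨$⟩ʳ v))
      ≡⟨ ∑ᴱ-∘-automorphism {τ} τ-aut (λ φ → δ (lookup φ x) (τ ⟨$⟩ʳ v)) ⟨
    ∑ᴱ (λ φ → δ (lookup (Vec.map (τ ⟨$⟩ʳ_) φ) x) (τ ⟨$⟩ʳ v))
      ≡⟨ ∑ᴱ-cong (λ φ _ → trans (cong (λ u → δ u (τ ⟨$⟩ʳ v)) (lookup-map x _ φ)) (δ-permute τ _ v)) ⟩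
    ∑ᴱ (λ φ → δ (lookup φ x) v) ∎
    where open ≡-Reasoning

  n*hits≡#E : ∀ x v → n * hits x v ≡ #E
  n*hits≡#E x v = begin
    n * hits x v             ≡⟨ sum-const n (hits x v) ⟨
    ∑[ u < n ] hits x v      ≡⟨ sum-cong-≗ hits-const ⟩
    ∑[ u < n ] hits x u      ≡⟨ ∑ᴱ-comm (λ φ → δ (lookup φ x)) ⟨
    ∑ᴱ (λ φ → sum (δ (lookup φ x)))  ≡⟨ ∑ᴱ-cong (λ φ _ → sum-δ (lookup φ x)) ⟩
    #E ∎
    where
    open ≡-Reasoning
    hits-const : ∀ u → hits x v ≡ hits x u
    hits-const u with vt v u
    ... | τ , τ-aut , τv≡u = trans (sym (hits-automorphism {τ} τ-aut x v)) (cong (hits x) τv≡u)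

  n*∑ᴱ-∈preimage : ∀ I x → n * ∑ᴱ (λ φ → [ I (lookup φ x) ]) ≡ count I * #E
  n*∑ᴱ-∈preimage I x = begin
    n * ∑ᴱ (λ φ → [ I (lookup φ x) ])
      ≡⟨ cong (n *_) (∑ᴱ-cong (λ φ _ → sym (sum-*δ (λ v → [ I v ]) (lookup φ x)))) ⟩
    n * ∑ᴱ (λ φ → ∑[ v < n ] ([ I v ] * δ (lookup φ x) v))
      ≡⟨ cong (n *_) (∑ᴱ-comm (λ φ v → [ I v ] * δ (lookup φ x) v)) ⟩
    n * ∑[ v < n ] ∑ᴱ (λ φ → [ I v ] * δ (lookup φ x) v)
      ≡⟨ cong (n *_) (sum-cong-≗ (λ v → *-distribˡ-∑ᴱ [ I v ] (λ φ → δ (lookup φ x) v))) ⟨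
    n * ∑[ v < n ] ([ I v ] * hits x v)
      ≡⟨ *-distribˡ-sum n (λ v → [ I v ] * hits x v) ⟩
    ∑[ v < n ] (n * ([ I v ] * hits x v))
      ≡⟨ sum-cong-≗ (λ v → trans (x∙yz≈y∙xz n [ I v ] (hits x v)) (cong ([ I v ] *_) (n*hits≡#E x v))) ⟩
    ∑[ v < n ] ([ I v ] * #E)
      ≡⟨ *-distribʳ-sum #E (λ v → [ I v ]) ⟨
    count I * #E ∎
    where open ≡-Reasoning

  n*∑ᴱ-count-∩-preimage : ∀ X I → n * ∑ᴱ (λ φ → count (X ∩ᵖ I ∘ lookup φ)) ≡ count X * count I * #E
  n*∑ᴱ-count-∩-preimage X I = begin
    n * ∑ᴱ (λ φ → ∑[ x < n ] [ X x ∧ I (lookup φ x) ])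
      ≡⟨ cong (n *_) (∑ᴱ-comm (λ φ x → [ X x ∧ I (lookup φ x) ])) ⟩
    n * ∑[ x < n ] ∑ᴱ (λ φ → [ X x ∧ I (lookup φ x) ])
      ≡⟨ cong (n *_) (sum-cong-≗ λ x →
           trans (∑ᴱ-cong (λ φ _ → []-∧ (X x) _)) (sym (*-distribˡ-∑ᴱ [ X x ] _))) ⟩
    n * ∑[ x < n ] ([ X x ] * ∑ᴱ (λ φ → [ I (lookup φ x) ]))
      ≡⟨ *-distribˡ-sum n (λ x → [ X x ] * ∑ᴱ (λ φ → [ I (lookup φ x) ])) ⟩
    ∑[ x < n ] (n * ([ X x ] * ∑ᴱ (λ φ → [ I (lookup φ x) ])))
      ≡⟨ sum-cong-≗ (λ x → trans (x∙yz≈y∙xz n [ X x ] _) (cong ([ X x ] *_) (n*∑ᴱ-∈preimage I x))) ⟩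
    ∑[ x < n ] ([ X x ] * (count I * #E))
      ≡⟨ *-distribʳ-sum (count I * #E) (λ x → [ X x ]) ⟨
    count X * (count I * #E)
      ≡⟨ *-assoc (count X) (count I) #E ⟨
    count X * count I * #E ∎
    where open ≡-Reasoning

  ∑ᴱ-count-∩-preimage : ∀ {{_ : NonZero n}} X I c → count X * count I ≡ n * c →
                        ∑ᴱ (λ φ → count (X ∩ᵖ I ∘ lookup φ)) ≡ c * #E
  ∑ᴱ-count-∩-preimage X I c ∣X∣∣I∣≡nc = *-cancelˡ-≡ _ _ n (begin
    n * ∑ᴱ (λ φ → count (X ∩ᵖ I ∘ lookup φ))  ≡⟨ n*∑ᴱ-count-∩-preimage X I ⟩
    count X * count I * #E                    ≡⟨ cong (_* #E) ∣X∣∣I∣≡nc ⟩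
    n * c * #E                                ≡⟨ *-assoc n c #E ⟩
    n * (c * #E)                              ∎)
    where open ≡-Reasoning

-- Tight independent sets

module TightSets {n : ℕ} (G : Graph n) (vt : VertexTransitive G) {{_ : NonZero n}} where
  open Independence G
  open Averaging G vt

  private instance
    #E-nonZero : NonZero #E
    #E-nonZero = >-nonZero #E-pos

  preimage-maximum : ∀ {I} φ → IsMaximum I → IsStrongEndo φ → IsMaximum (I ∘ lookup φ)
  preimage-maximum {I} φ (indI , ∣I∣≡α) φ-endo =
    IsIndependent-preimage φ φ-endo indI ,
    ∑ᴱ-upperBound-tight (αG G) (λ ψ ψ-endo → count≤αG (IsIndependent-preimage ψ ψ-endo indI))
      (≤-reflexive (sym (∑ᴱ-count-∩-preimage (λ _ → true) I (αG G) (cong₂ _*_ (count-⊤ {n}) ∣I∣≡α)))) φ φ-endo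

  count-∩-maximum-const : ∀ X c → (∀ {I} → IsMaximum I → count (X ∩ᵖ I) ≡ c) → count X * αG G ≡ n * c
  count-∩-maximum-const X c ∣X∩I∣≡c with maximum-exists
  ... | I , maxI = *-cancelʳ-≡ _ _ #E (begin
    count X * αG G * #E                       ≡⟨ cong (λ a → count X * a * #E) (proj₂ maxI) ⟨
    count X * count I * #E                    ≡⟨ n*∑ᴱ-count-∩-preimage X I ⟨
    n * ∑ᴱ (λ φ → count (X ∩ᵖ I ∘ lookup φ))  ≡⟨ cong (n *_) (∑ᴱ-cong ∣X∩I∘φ∣≡c) ⟩
    n * ∑ᴱ (λ _ → c)                          ≡⟨ cong (n *_) (∑ᴱ-const c) ⟩
    n * (c * #E)                              ≡⟨ *-assoc n c #E ⟨
    n * c * #E                                ∎)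
    where
    open ≡-Reasoning
    ∣X∩I∘φ∣≡c : ∀ φ → IsStrongEndo φ → count (X ∩ᵖ I ∘ lookup φ) ≡ c
    ∣X∩I∘φ∣≡c φ φ-endo = ∣X∩I∣≡c (preimage-maximum φ maxI φ-endo)

  -- Imprimitive G A says exactly that lookup A is tight with 0 < |A| < α(G).
  IsTight : (Fin n → Bool) → Set
  IsTight P = IsIndependent P × count P * n ≡ αG G * count N[ P ]

  tight-∩-maximum : ∀ {P J} → IsTight P → IsMaximum J → count (J ∩ᵖ N[ P ]) ≡ count P
  tight-∩-maximum {P} {J} (indP , tight) maxJ = begin
    count (J ∩ᵖ N[ P ])                            ≡⟨ count-cong (λ x → ∧-comm (J x) _) ⟩
    count (N[ P ] ∩ᵖ J)
      ≡⟨ count-cong (λ x → cong (λ y → N[ P ] x ∧ J y) (lookup-allFin x)) ⟨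
    count (N[ P ] ∩ᵖ J ∘ lookup (Vec.allFin n))
      ≡⟨ ∑ᴱ-lowerBound-tight (count P) P≤N[P]∩J∘φ (≤-reflexive ∑ᴱ≡∣P∣#E) (Vec.allFin n) id-endo ⟩
    count P                                        ∎
    where
    open ≡-Reasoning
    P≤N[P]∩J∘φ : ∀ φ → IsStrongEndo φ → count P ≤ count (N[ P ] ∩ᵖ J ∘ lookup φ)
    P≤N[P]∩J∘φ φ φ-endo = subst (count P ≤_) (count-cong (λ x → ∧-comm (J (lookup φ x)) _))
                    (exchange (preimage-maximum φ maxJ φ-endo) indP)
    ∑ᴱ≡∣P∣#E : ∑ᴱ (λ φ → count (N[ P ] ∩ᵖ J ∘ lookup φ)) ≡ count P * #E
    ∑ᴱ≡∣P∣#E = ∑ᴱ-count-∩-preimage N[ P ] J (count P)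
            (trans (cong (count N[ P ] *_) (proj₂ maxJ))
                   (trans (*-comm _ (αG G)) (trans (sym tight) (*-comm _ n))))

  maximum-∩-∁N[] : ∀ {P I} → IsTight P → IsMaximum I → count P + count (I ∩ᵖ ∁ᵖ N[ P ]) ≡ αG G
  maximum-∩-∁N[] {P} {I} tightP maxI =
    trans (cong (_+ count (I ∩ᵖ ∁ᵖ N[ P ])) (sym (tight-∩-maximum tightP maxI)))
          (trans (sym (count-split I N[ P ])) (proj₂ maxI))

  tight-∪-maximum : ∀ {P I} → IsTight P → IsMaximum I → IsMaximum (P ∪ᵖ (I ∩ᵖ ∁ᵖ N[ P ]))
  tight-∪-maximum {P} {I} tightP maxI =
    IsIndependent-∪-∁N[] (proj₁ tightP) (IsIndependent-⊆ (λ x → ∧-conicalˡ _ _) (proj₁ maxI)) I∩∁N⊆∁N ,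
    trans (count-∪-∁N[] I∩∁N⊆∁N) (maximum-∩-∁N[] tightP maxI)
    where
    I∩∁N⊆∁N : (I ∩ᵖ ∁ᵖ N[ P ]) ⊆ᵖ ∁ᵖ N[ P ]
    I∩∁N⊆∁N x = ∧-conicalʳ (I x) _

  ∁N[]-nonempty : ∀ {P} → IsTight P → count P < αG G → 0 < count (∁ᵖ N[ P ])
  ∁N[]-nonempty {P} (_ , tight) ∣P∣<α = n≢0⇒n>0 λ ∣∁N∣≡0 →
    <⇒≢ ∣P∣<α (*-cancelʳ-≡ _ _ n (trans tight (cong (αG G *_) (∣N∣≡n ∣∁N∣≡0))))
    where
    ∣N∣≡n : count (∁ᵖ N[ P ]) ≡ 0 → count N[ P ] ≡ n
    ∣N∣≡n ∣∁N∣≡0 = sym (trans (n≡count+count∁ N[ P ]) (trans (cong (count N[ P ] +_) ∣∁N∣≡0) (+-identityʳ _)))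

  α-∁N[] : ∀ {P} X → IsTight P → (∀ x → lookup X x ≡ ∁ᵖ N[ P ] x) →
           α G X * n ≡ αG G * count (∁ᵖ N[ P ])
  α-∁N[] {P} X (indP , tight) X≗∁N = ≤-antisym upper lower
    where
    open ≤-Reasoning
    B : Fin n → Bool
    B = ∁ᵖ N[ P ]
    upper : α G X * n ≤ αG G * count B
    upper with α-attained X
    ... | S , indS , S⊆X , ∣S∣≡αX = +-cancelˡ-≤ (count P * n) _ _ (begin
      count P * n + α G X * n               ≡⟨ *-distribʳ-+ n (count P) (α G X) ⟨
      (count P + α G X) * n                 ≤⟨ *-monoˡ-≤ n P∪S≤α ⟩
      αG G * n                              ≡⟨ cong (αG G *_) (n≡count+count∁ N[ P ]) ⟩
      αG G * (count N[ P ] + count B)       ≡⟨ *-distribˡ-+ (αG G) _ _ ⟩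
      αG G * count N[ P ] + αG G * count B  ≡⟨ cong (_+ αG G * count B) tight ⟨
      count P * n + αG G * count B          ∎)
      where
      P∪S≤α : count P + α G X ≤ αG G
      P∪S≤α = subst (λ a → count P + a ≤ αG G) ∣S∣≡αX
                (count-∪-∁N[]≤αG indP indS (λ x Sx → trans (sym (X≗∁N x)) (S⊆X x Sx)))
    lower : αG G * count B ≤ α G X * n
    lower with maximum-exists
    ... | I , indI , ∣I∣≡α = *-cancelʳ-≤ _ _ #E (begin
      αG G * count B * #E
        ≡⟨ cong (_* #E) (trans (*-comm (αG G) _) (cong (count B *_) (sym ∣I∣≡α))) ⟩
      count B * count I * #E
        ≡⟨ n*∑ᴱ-count-∩-preimage B I ⟨
      n * ∑ᴱ (λ φ → count (B ∩ᵖ I ∘ lookup φ))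
        ≤⟨ *-monoʳ-≤ n (∑ᴱ-upperBound (α G X) fits) ⟩
      n * (α G X * #E)
        ≡⟨ trans (cong (_* #E) (*-comm (α G X) n)) (*-assoc n _ _) ⟨
      α G X * n * #E ∎)
      where
      fits : ∀ φ → IsStrongEndo φ → count (B ∩ᵖ I ∘ lookup φ) ≤ α G X
      fits φ φ-endo =
        α-upper X (IsIndependent-⊆ (λ x → ∧-conicalʳ (B x) _) (IsIndependent-preimage φ φ-endo indI))
                        (λ x x∈ → trans (X≗∁N x) (∧-conicalˡ _ _ x∈))

  module _ {P Q} (tightP : IsTight P) (tightQ : IsTight Q) (∣Q∣≡∣P∣ : count Q ≡ count P) where

    private
      Y : Fin n → Bool
      Y = Q ∩ᵖ ∁ᵖ N[ P ]

      Y⊆∁N[P] : Y ⊆ᵖ ∁ᵖ N[ P ]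
      Y⊆∁N[P] x = ∧-conicalʳ (Q x) _

      indY : IsIndependent Y
      indY = IsIndependent-⊆ (λ x → ∧-conicalˡ _ _) (proj₁ tightQ)

      -- The part of I ∖ N[P] dominated by Y: it has at least |Y| and at most |P| − |P ∩ N[Q]| elements.
      W : (Fin n → Bool) → Fin n → Bool
      W I = (I ∩ᵖ ∁ᵖ N[ P ]) ∩ᵖ N[ Y ]

      ∣P∣≡∣Y∣+∣Q∩N[P]∣ : count P ≡ count Y + count (Q ∩ᵖ N[ P ])
      ∣P∣≡∣Y∣+∣Q∩N[P]∣ = trans (sym ∣Q∣≡∣P∣) (trans (count-split Q N[ P ]) (+-comm _ (count Y)))

      ∣P∩N[Q]∣+∣W∣≤∣P∣ : ∀ {I} → IsMaximum I → count (P ∩ᵖ N[ Q ]) + count (W I) ≤ count P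
      ∣P∩N[Q]∣+∣W∣≤∣P∣ {I} maxI = begin
        count (P ∩ᵖ N[ Q ]) + count (W I)     ≡⟨ count-∪ (P ∩ᵖ N[ Q ]) (W I) disjoint ⟨
        count ((P ∩ᵖ N[ Q ]) ∪ᵖ W I)          ≤⟨ count-mono ⊆J∩N[Q] ⟩
        count (J ∩ᵖ N[ Q ])                   ≡⟨ tight-∩-maximum tightQ (tight-∪-maximum tightP maxI) ⟩
        count Q                               ≡⟨ ∣Q∣≡∣P∣ ⟩
        count P                               ∎
        where
        open ≤-Reasoning
        J : Fin n → Bool
        J = P ∪ᵖ (I ∩ᵖ ∁ᵖ N[ P ])
        disjoint : Disjointᵖ (P ∩ᵖ N[ Q ]) (W I)
        disjoint x x∈ = ≢true⇒≡false λ x∈W →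
          true≢false (trans (sym (∧-conicalʳ (I x) _ (∧-conicalˡ _ _ x∈W))) (P∩∁N[P]≡∅ x (∧-conicalˡ _ _ x∈)))
        ⊆J∩N[Q] : ((P ∩ᵖ N[ Q ]) ∪ᵖ W I) ⊆ᵖ (J ∩ᵖ N[ Q ])
        ⊆J∩N[Q] x x∈ with ∨-elim {P x ∧ N[ Q ] x} x∈
        ... | inj₁ x∈P∩N = ∧-intro (∨-introˡ (I x ∧ ∁ᵖ N[ P ] x) (∧-conicalˡ (P x) _ x∈P∩N))
                                   (∧-conicalʳ (P x) _ x∈P∩N)
        ... | inj₂ x∈W   = ∧-intro (∨-introʳ (P x) (∧-conicalˡ (I x ∧ ∁ᵖ N[ P ] x) _ x∈W))
                                   (N[]-mono (λ y → ∧-conicalˡ _ _) x (∧-conicalʳ (I x ∧ _) _ x∈W))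

      ∣Y∣≤∣W∣ : ∀ {I} → IsMaximum I → count Y ≤ count (W I)
      ∣Y∣≤∣W∣ {I} maxI = ≤-trans (exchange (tight-∪-maximum tightP maxI) indY) (count-mono J∩N[Y]⊆W)
        where
        J∩N[Y]⊆W : ((P ∪ᵖ (I ∩ᵖ ∁ᵖ N[ P ])) ∩ᵖ N[ Y ]) ⊆ᵖ W I
        J∩N[Y]⊆W x x∈ with ∨-elim {P x} (∧-conicalˡ _ _ x∈)
        ... | inj₁ Px    =
          ⊥-elim (true≢false (trans (sym (∧-conicalʳ (P x ∨ _) _ x∈)) (not≡true⇒≡false (⊆∁N[]-sym Y⊆∁N[P] x Px))))
        ... | inj₂ x∈I∩∁N = ∧-intro x∈I∩∁N (∧-conicalʳ (P x ∨ _) _ x∈)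

    crossing-≤ : count (P ∩ᵖ N[ Q ]) ≤ count (Q ∩ᵖ N[ P ])
    crossing-≤ with maximum-exists
    ... | I , maxI = +-cancelˡ-≤ (count Y) _ _ (begin
      count Y + count (P ∩ᵖ N[ Q ])          ≡⟨ +-comm (count Y) _ ⟩
      count (P ∩ᵖ N[ Q ]) + count Y          ≤⟨ +-monoʳ-≤ (count (P ∩ᵖ N[ Q ])) (∣Y∣≤∣W∣ maxI) ⟩
      count (P ∩ᵖ N[ Q ]) + count (W I)      ≤⟨ ∣P∩N[Q]∣+∣W∣≤∣P∣ maxI ⟩
      count P                                ≡⟨ ∣P∣≡∣Y∣+∣Q∩N[P]∣ ⟩
      count Y + count (Q ∩ᵖ N[ P ])          ∎)
      where open ≤-Reasoning

    module _ (crossing-≥ : count (Q ∩ᵖ N[ P ]) ≤ count (P ∩ᵖ N[ Q ])) where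

      private
        ∣W∣≡∣Y∣ : ∀ {I} → IsMaximum I → count (W I) ≡ count Y
        ∣W∣≡∣Y∣ {I} maxI = ≤-antisym (+-cancelˡ-≤ (count (P ∩ᵖ N[ Q ])) _ _ (begin
          count (P ∩ᵖ N[ Q ]) + count (W I)  ≤⟨ ∣P∩N[Q]∣+∣W∣≤∣P∣ maxI ⟩
          count P                            ≡⟨ ∣P∣≡∣Y∣+∣Q∩N[P]∣ ⟩
          count Y + count (Q ∩ᵖ N[ P ])      ≤⟨ +-monoʳ-≤ (count Y) crossing-≥ ⟩
          count Y + count (P ∩ᵖ N[ Q ])      ≡⟨ +-comm (count Y) _ ⟩
          count (P ∩ᵖ N[ Q ]) + count Y      ∎)) (∣Y∣≤∣W∣ maxI)
          where open ≤-Reasoning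

        ∨∧∧-absorb : ∀ p y i → ((p ∨ y) ∧ i) ∧ p ≡ i ∧ p
        ∨∧∧-absorb true  y i = refl
        ∨∧∧-absorb false y i = trans (∧-zeroʳ (y ∧ i)) (sym (∧-zeroʳ i))

        ∨∧∧not-restrict : ∀ p y i → ((p ∨ y) ∧ i) ∧ not p ≡ (i ∧ not p) ∧ y
        ∨∧∧not-restrict true  y i = trans (∧-zeroʳ i) (sym (cong (_∧ y) (∧-zeroʳ i)))
        ∨∧∧not-restrict false y i =
          trans (∧-identityʳ (y ∧ i)) (trans (∧-comm y i) (cong (_∧ y) (sym (∧-identityʳ i))))

      tight-∪-∩∁N[] : IsTight (P ∪ᵖ (Q ∩ᵖ ∁ᵖ N[ P ]))
      tight-∪-∩∁N[] = IsIndependent-∪-∁N[] (proj₁ tightP) indY Y⊆∁N[P] , (begin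
        count (P ∪ᵖ Y) * n         ≡⟨ cong (_* n) (count-∪-∁N[] Y⊆∁N[P]) ⟩
        (count P + count Y) * n    ≡⟨ *-comm _ n ⟩
        n * (count P + count Y)    ≡⟨ count-∩-maximum-const N[ P ∪ᵖ Y ] _ ∣N[P∪Y]∩I∣ ⟨
        count N[ P ∪ᵖ Y ] * αG G   ≡⟨ *-comm _ (αG G) ⟩
        αG G * count N[ P ∪ᵖ Y ]   ∎)
        where
        open ≡-Reasoning
        ∣N[P∪Y]∩I∣ : ∀ {I} → IsMaximum I → count (N[ P ∪ᵖ Y ] ∩ᵖ I) ≡ count P + count Y
        ∣N[P∪Y]∩I∣ {I} maxI = begin
          count (N[ P ∪ᵖ Y ] ∩ᵖ I)
            ≡⟨ count-split _ N[ P ] ⟩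
          count ((N[ P ∪ᵖ Y ] ∩ᵖ I) ∩ᵖ N[ P ]) + count ((N[ P ∪ᵖ Y ] ∩ᵖ I) ∩ᵖ ∁ᵖ N[ P ])
            ≡⟨ cong₂ _+_ (count-cong inside) (count-cong outside) ⟩
          count (I ∩ᵖ N[ P ]) + count (W I)
            ≡⟨ cong₂ _+_ (tight-∩-maximum tightP maxI) (∣W∣≡∣Y∣ maxI) ⟩
          count P + count Y ∎
          where
          inside : ∀ x → (N[ P ∪ᵖ Y ] x ∧ I x) ∧ N[ P ] x ≡ I x ∧ N[ P ] x
          inside x = trans (cong (λ b → (b ∧ I x) ∧ N[ P ] x) (N[]-∪ P Y x))
                           (∨∧∧-absorb (N[ P ] x) (N[ Y ] x) (I x))
          outside : ∀ x → (N[ P ∪ᵖ Y ] x ∧ I x) ∧ ∁ᵖ N[ P ] x ≡ W I x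
          outside x = trans (cong (λ b → (b ∧ I x) ∧ ∁ᵖ N[ P ] x) (N[]-∪ P Y x))
                            (∨∧∧not-restrict (N[ P ] x) (N[ Y ] x) (I x))

  maximum-∋ : 0 < αG G → ∀ v → ∃ λ I → IsMaximum I × I v ≡ true
  maximum-∋ 0<α v with maximum-exists
  ... | I , maxI with count-pos⇒∈ (subst (0 <_) (sym (proj₂ maxI)) 0<α)
  ... | u , Iu with vt v u
  ... | τ , τ-aut , τv≡u = I ∘ (τ ⟨$⟩ʳ_) , maximum-∘-automorphism {τ} τ-aut maxI , trans (cong I τv≡u) Iu

  -- For a maximum I ∋ v, both I ∖ N[P] and its part outside N[Q] have α(G) − |P| elements: the latter
  -- is the trace outside N[Q] of the maximum set P ∪ (I ∖ N[P]), since P ⊆ N[Q].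
  ⊆N[]⇒∁N[]-⊆ : ∀ {P Q} → 0 < αG G → IsTight P → IsTight Q → count Q ≡ count P →
                P ⊆ᵖ N[ Q ] → ∁ᵖ N[ P ] ⊆ᵖ ∁ᵖ N[ Q ]
  ⊆N[]⇒∁N[]-⊆ {P} {Q} 0<α tightP tightQ ∣Q∣≡∣P∣ P⊆N[Q] v v∉N[P] with maximum-∋ 0<α v
  ... | I , maxI , Iv =
    ∧-conicalʳ (I v ∧ _) _ (count-≤⇒⊇ (λ x → ∧-conicalˡ _ _) (≤-reflexive ∣I∩∁N[P]∣≡) v (∧-intro Iv v∉N[P]))
    where
    I∩∁N[P] : Fin n → Bool
    I∩∁N[P] = I ∩ᵖ ∁ᵖ N[ P ]
    restrict : ∀ x → ((P ∪ᵖ I∩∁N[P]) ∩ᵖ ∁ᵖ N[ Q ]) x ≡ (I∩∁N[P] ∩ᵖ ∁ᵖ N[ Q ]) x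
    restrict x = drop (P x) (I∩∁N[P] x) (λ Px → cong not (P⊆N[Q] x Px))
      where
      drop : ∀ p r {q} → (p ≡ true → q ≡ false) → (p ∨ r) ∧ q ≡ r ∧ q
      drop true  r p⇒¬q rewrite p⇒¬q refl = sym (∧-zeroʳ r)
      drop false r _    = refl
    ∣I∩∁N[P]∣≡ : count I∩∁N[P] ≡ count (I∩∁N[P] ∩ᵖ ∁ᵖ N[ Q ])
    ∣I∩∁N[P]∣≡ = +-cancelˡ-≡ (count P) _ _ (begin
      count P + count I∩∁N[P]                         ≡⟨ maximum-∩-∁N[] tightP maxI ⟩
      αG G                                            ≡⟨ maximum-∩-∁N[] tightQ (tight-∪-maximum tightP maxI) ⟨
      count Q + count ((P ∪ᵖ I∩∁N[P]) ∩ᵖ ∁ᵖ N[ Q ])    ≡⟨ cong₂ _+_ ∣Q∣≡∣P∣ (count-cong restrict) ⟩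
      count P + count (I∩∁N[P] ∩ᵖ ∁ᵖ N[ Q ])           ∎)
      where open ≡-Reasoning

  module _ {P} (tightP : IsTight P) (0<∣P∣ : 0 < count P)
           (P-largest : ∀ {R} → IsTight R → 0 < count R → count R < αG G → count R ≤ count P) where

    -- P ∪ (Q ∖ N[P]) is tight and can be extended by t, so it is imprimitive; the maximality of |P|
    -- leaves no room for Q ∖ N[P].
    ∁N[]-meet⇒⊆N[] : ∀ {Q} → IsTight Q → count Q ≡ count P →
                     ∀ t → ∁ᵖ N[ P ] t ≡ true → ∁ᵖ N[ Q ] t ≡ true → Q ⊆ᵖ N[ P ]
    ∁N[]-meet⇒⊆N[] {Q} tightQ ∣Q∣≡∣P∣ t t∉N[P] t∉N[Q] x Qx =
      not≡false⇒≡true (≢true⇒≡false λ x∈∁N → true≢false (trans (sym (∧-intro Qx x∈∁N)) (count≡0 ∣Y∣≡0 x)))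
      where
      Y Z ⁅t⁆ : Fin n → Bool
      Y = Q ∩ᵖ ∁ᵖ N[ P ]
      Z = P ∪ᵖ Y
      ⁅t⁆ x = does (t ≟ x)
      tightZ : IsTight Z
      tightZ = tight-∪-∩∁N[] tightP tightQ ∣Q∣≡∣P∣ (crossing-≤ tightQ tightP (sym ∣Q∣≡∣P∣))
      ∣Z∣≡∣P∣+∣Y∣ : count Z ≡ count P + count Y
      ∣Z∣≡∣P∣+∣Y∣ = count-∪-∁N[] (λ x → ∧-conicalʳ (Q x) _)
      ⁅t⁆-sound : ∀ {x} → ⁅t⁆ x ≡ true → t ≡ x
      ⁅t⁆-sound {x} t≟x with t ≟ x
      ... | yes t≡x = t≡x
      ind⁅t⁆ : IsIndependent ⁅t⁆
      ind⁅t⁆ x y x≡t y≡t rewrite sym (⁅t⁆-sound x≡t) | sym (⁅t⁆-sound y≡t) = irrefl G t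
      ⁅t⁆⊆∁N[Z] : ⁅t⁆ ⊆ᵖ ∁ᵖ N[ Z ]
      ⁅t⁆⊆∁N[Z] x x≡t rewrite sym (⁅t⁆-sound x≡t) = ≡false⇒not≡true (begin
        N[ Z ] t                    ≡⟨ N[]-∪ P Y t ⟩
        N[ P ] t ∨ N[ Y ] t         ≡⟨ cong₂ _∨_ (not≡true⇒≡false t∉N[P]) t∉N[Y] ⟩
        false                       ∎)
        where
        open ≡-Reasoning
        t∉N[Y] : N[ Y ] t ≡ false
        t∉N[Y] = ≢true⇒≡false λ t∈N[Y] →
          true≢false (trans (sym (N[]-mono (λ y → ∧-conicalˡ (Q y) _) t t∈N[Y])) (not≡true⇒≡false t∉N[Q]))
      ∣Z∣<α : count Z < αG G
      ∣Z∣<α = subst (_≤ αG G) (trans (cong (count Z +_) (sum-δ t)) (+-comm (count Z) 1))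
                (count-∪-∁N[]≤αG (proj₁ tightZ) ind⁅t⁆ ⁅t⁆⊆∁N[Z])
      0<∣Z∣ : 0 < count Z
      0<∣Z∣ = ≤-trans 0<∣P∣ (subst (count P ≤_) (sym ∣Z∣≡∣P∣+∣Y∣) (m≤m+n _ _))
      ∣Y∣≡0 : count Y ≡ 0
      ∣Y∣≡0 = n≤0⇒n≡0 (+-cancelˡ-≤ (count P) _ _ (begin
        count P + count Y   ≡⟨ ∣Z∣≡∣P∣+∣Y∣ ⟨
        count Z             ≤⟨ P-largest tightZ 0<∣Z∣ ∣Z∣<α ⟩
        count P             ≡⟨ +-identityʳ (count P) ⟨
        count P + 0         ∎))
        where open ≤-Reasoning

  ∁N[]-disjoint-or-equal : ∀ {P Q} → IsTight P → 0 < count P →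
    (∀ {R} → IsTight R → 0 < count R → count R < αG G → count R ≤ count P) →
    IsTight Q → count Q ≡ count P →
    (∀ t → ∁ᵖ N[ P ] t ∧ ∁ᵖ N[ Q ] t ≡ false) ⊎ (∀ x → ∁ᵖ N[ P ] x ≡ ∁ᵖ N[ Q ] x)
  ∁N[]-disjoint-or-equal {P} {Q} tightP 0<∣P∣ P-largest tightQ ∣Q∣≡∣P∣
    with any? (λ t → ∁ᵖ N[ P ] t ∧ ∁ᵖ N[ Q ] t ≟ᵇ true)
  ... | no  ∄t       = inj₁ (λ t → ≢true⇒≡false (λ t∈ → ∄t (t , t∈)))
  ... | yes (t , t∈) = inj₂ (⊆ᵖ-antisym (⊆N[]⇒∁N[]-⊆ 0<α tightP tightQ ∣Q∣≡∣P∣ P⊆N[Q])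
                                        (⊆N[]⇒∁N[]-⊆ 0<α tightQ tightP (sym ∣Q∣≡∣P∣) Q⊆N[P]))
    where
    0<α : 0 < αG G
    0<α = ≤-trans 0<∣P∣ (count≤αG (proj₁ tightP))
    t∉N[P] : ∁ᵖ N[ P ] t ≡ true
    t∉N[P] = ∧-conicalˡ _ _ t∈
    t∉N[Q] : ∁ᵖ N[ Q ] t ≡ true
    t∉N[Q] = ∧-conicalʳ (∁ᵖ N[ P ] t) _ t∈
    Q⊆N[P] : Q ⊆ᵖ N[ P ]
    Q⊆N[P] = ∁N[]-meet⇒⊆N[] tightP 0<∣P∣ P-largest tightQ ∣Q∣≡∣P∣ t t∉N[P] t∉N[Q]
    P⊆N[Q] : P ⊆ᵖ N[ Q ]
    P⊆N[Q] = ∁N[]-meet⇒⊆N[] tightQ (subst (0 <_) (sym ∣Q∣≡∣P∣) 0<∣P∣)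
               (λ tightR 0<∣R∣ ∣R∣<α → subst (_ ≤_) (sym ∣Q∣≡∣P∣) (P-largest tightR 0<∣R∣ ∣R∣<α))
               tightP (sym ∣Q∣≡∣P∣) t t∉N[Q] t∉N[P]

  tight-∘-automorphism : ∀ {τ P} → IsAutomorphism G τ → IsTight P → IsTight (P ∘ (τ ⟨$⟩ʳ_))
  tight-∘-automorphism {τ} {P} τ-aut (indP , tight) = IsIndependent-∘-automorphism {τ} τ-aut indP , (begin
    count (P ∘ (τ ⟨$⟩ʳ_)) * n          ≡⟨ cong (_* n) (count-permute τ P) ⟩
    count P * n                         ≡⟨ tight ⟩
    αG G * count N[ P ]                 ≡⟨ cong (αG G *_) (count-permute τ N[ P ]) ⟨
    αG G * count (N[ P ] ∘ (τ ⟨$⟩ʳ_))   ≡⟨ cong (αG G *_) (count-cong (N[]-∘-automorphism {τ} τ-aut P)) ⟨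
    αG G * count N[ P ∘ (τ ⟨$⟩ʳ_) ]     ∎)
    where open ≡-Reasoning

  count-closedNbhd : ∀ S → ∣ closedNbhd G S ∣ ≡ count N[ lookup S ]
  count-closedNbhd S = trans (∣∣≡count (closedNbhd G S)) (count-cong (lookup-closedNbhd S))

  Imprimitive⇒IsTight : ∀ {A} → Imprimitive G A → IsTight (lookup A)
  Imprimitive⇒IsTight {A} (indA , _ , _ , ratio) =
    Independent⇒IsIndependent A indA ,
    subst₂ (λ a b → a * n ≡ αG G * b) (∣∣≡count A) (count-closedNbhd A) ratio

  IsTight⇒Imprimitive : ∀ {R} → IsTight R → 0 < count R → count R < αG G → Imprimitive G (tabulate R)
  IsTight⇒Imprimitive {R} (indR , tight) 0<∣R∣ ∣R∣<α =
    IsIndependent⇒Independent S (IsIndependent-⊆ (λ x → trans (R≗S x)) indR) ,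
    subst (0 <_) (sym ∣S∣≡∣R∣) 0<∣R∣ ,
    subst (_< αG G) (sym ∣S∣≡∣R∣) ∣R∣<α ,
    subst₂ (λ a b → a * n ≡ αG G * b) (sym ∣S∣≡∣R∣) (sym ∣N[S]∣≡∣N[R]∣) tight
    where
    S : Subset n
    S = tabulate R
    R≗S : ∀ x → R x ≡ lookup S x
    R≗S x = sym (lookup∘tabulate R x)
    ∣S∣≡∣R∣ : ∣ S ∣ ≡ count R
    ∣S∣≡∣R∣ = trans (∣∣≡count S) (count-cong (sym ∘ R≗S))
    ∣N[S]∣≡∣N[R]∣ : ∣ closedNbhd G S ∣ ≡ count N[ R ]
    ∣N[S]∣≡∣N[R]∣ = trans (count-closedNbhd S) (count-cong (N[]-cong (sym ∘ R≗S)))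

-- Largest imprimitive sets

module LargestImprimitive {n : ℕ} {{_ : NonZero n}} (G : Graph n) (vt : VertexTransitive G)
    {A : Subset n} (impA : Imprimitive G A) (A-largest : ∀ A′ → Imprimitive G A′ → ∣ A′ ∣ ≤ ∣ A ∣) where
  open Independence G
  open TightSets G vt

  private
    P : Fin n → Bool
    P = lookup A
    tightP : IsTight P
    tightP = Imprimitive⇒IsTight impA
    0<∣P∣ : 0 < count P
    0<∣P∣ = subst (0 <_) (∣∣≡count A) (proj₁ (proj₂ impA))
    ∣P∣<α : count P < αG G
    ∣P∣<α = subst (_< αG G) (∣∣≡count A) (proj₁ (proj₂ (proj₂ impA)))
    P-largest : ∀ {R} → IsTight R → 0 < count R → count R < αG G → count R ≤ count P
    P-largest {R} tightR 0<∣R∣ ∣R∣<α =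
      subst₂ _≤_ (trans (∣∣≡count (tabulate R)) (count-cong (lookup∘tabulate R))) (∣∣≡count A)
        (A-largest _ (IsTight⇒Imprimitive tightR 0<∣R∣ ∣R∣<α))

  B : Subset n
  B = ∁ (closedNbhd G A)

  private
    B≗ : ∀ x → lookup B x ≡ ∁ᵖ N[ P ] x
    B≗ x = trans (lookup-map x not (closedNbhd G A)) (cong not (lookup-closedNbhd A x))
    ∣B∣≡ : ∣ B ∣ ≡ count (∁ᵖ N[ P ])
    ∣B∣≡ = trans (∣∣≡count B) (count-cong B≗)

  0<∣B∣ : 0 < ∣ B ∣
  0<∣B∣ = subst (0 <_) (sym ∣B∣≡) (∁N[]-nonempty tightP ∣P∣<α)

  α[B]*n≡α*∣B∣ : α G B * n ≡ αG G * ∣ B ∣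
  α[B]*n≡α*∣B∣ = trans (α-∁N[] B tightP B≗) (cong (αG G *_) (sym ∣B∣≡))

  image-disjoint-or-equal : ∀ σ → IsAutomorphism G σ → (image σ B ∩ B ≡ ⊥) ⊎ (image σ B ≡ B)
  image-disjoint-or-equal σ σ-aut =
    Sum.map disjoint⇒ equal⇒ (∁N[]-disjoint-or-equal tightP 0<∣P∣ P-largest tightQ (count-permute (flip σ) P))
    where
    Q : Fin n → Bool
    Q = P ∘ (σ ⟨$⟩ˡ_)
    σ⁻¹-aut : IsAutomorphism G (flip σ)
    σ⁻¹-aut = automorphism-inverse {σ} σ-aut
    tightQ : IsTight Q
    tightQ = tight-∘-automorphism {flip σ} σ⁻¹-aut tightP
    σB≗ : ∀ y → lookup (image σ B) y ≡ ∁ᵖ N[ Q ] y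
    σB≗ y = trans (lookup∘tabulate (λ z → lookup B (σ ⟨$⟩ˡ z)) y)
              (trans (B≗ (σ ⟨$⟩ˡ y)) (cong not (sym (N[]-∘-automorphism {flip σ} σ⁻¹-aut P y))))
    disjoint⇒ : (∀ y → ∁ᵖ N[ P ] y ∧ ∁ᵖ N[ Q ] y ≡ false) → image σ B ∩ B ≡ ⊥
    disjoint⇒ disjoint = lookup-ext λ y → begin
      lookup (image σ B ∩ B) y           ≡⟨ lookup-zipWith _∧_ y (image σ B) B ⟩
      lookup (image σ B) y ∧ lookup B y  ≡⟨ cong₂ _∧_ (σB≗ y) (B≗ y) ⟩
      ∁ᵖ N[ Q ] y ∧ ∁ᵖ N[ P ] y           ≡⟨ ∧-comm (∁ᵖ N[ Q ] y) _ ⟩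
      ∁ᵖ N[ P ] y ∧ ∁ᵖ N[ Q ] y           ≡⟨ disjoint y ⟩
      false                              ≡⟨ lookup-replicate y false ⟨
      lookup ⊥ y                         ∎
      where open ≡-Reasoning
    equal⇒ : (∀ y → ∁ᵖ N[ P ] y ≡ ∁ᵖ N[ Q ] y) → image σ B ≡ B
    equal⇒ same = lookup-ext λ y → trans (σB≗ y) (trans (sym (same y)) (sym (B≗ y)))

proposition2p4 : (n : ℕ) (G : Graph n) → VertexTransitive G →
    (A : Subset n) → Imprimitive G A →
    (∀ A′ → Imprimitive G A′ → ∣ A′ ∣ ≤ ∣ A ∣) →
    let B = ∁ (closedNbhd G A) in
    (0 < ∣ B ∣ × α G B * n ≡ αG G * ∣ B ∣)
    × (∀ (σ : Permutation′ n) → IsAutomorphism G σ →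
    (image σ B ∩ B ≡ ⊥) ⊎ (image σ B ≡ B))
proposition2p4 zero    G vt [] (_ , () , _) _
proposition2p4 (suc m) G vt A impA A-largest = (0<∣B∣ , α[B]*n≡α*∣B∣) , image-disjoint-or-equal
  where open LargestImprimitive G vt impA A-largest
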